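{- Let $G$ be a graph with Hamilton cycle $H$ and auxiliary graph $A=A(G,H)$. Let $S\subseteq A$ be a disjoint union of colour-alternating cycles without neighbouring vertices, and let $U$ be an ordered subgraph of $A$ without neighbouring vertices that is a going-up version of $S$. Then the $2$-factor $F(U)$ has exactly one component more than $F(S)$.
   Context: For a graph $G$ on $n$ vertices with Hamilton cycle $H=v_1v_2\dots v_nv_1$ (indices mod $n$), write $e_i=v_iv_{i+1}$; an inner edge is an edge of $G$ not in $H$. The auxiliary graph $A=A(G,H)$ is the $2$-edge-coloured graph on $\{e_1,\dots,e_n\}$, linearly ordered $e_1<\dots<e_n$, with a red edge $e_ie_j$ iff $v_{i+1}v_{j+1}$ is an inner edge of $G$ and a blue edge $e_ie_j$ iff $v_iv_j$ is an inner edge (a pair may get both colours). For a red edge $\ell=e_ie_j$ put $e(\ell)=v_{i+1}v_{j+1}$; for a blue one $e(\ell)=v_iv_j$. A subgraph of $A$ carries the order inherited from $A$ (an ordered subgraph). A ($2$-edge-coloured, ordered) graph $S$ is a disjoint union of colour-alternating cycles if every vertex of $S$ is incident in $S$ to exactly one red and one blue edge; its components are colour-alternating cycles (length $2$ allowed: a red and a blue edge on the same pair). A subgraph $S\subseteq A$ has no neighbouring vertices if no two of its vertices are $e_i,e_{i+1}$ (indices mod $n$). For such $S$, $F(S)$ is the spanning subgraph of $G$ with edge set $(\{e_1,\dots,e_n\}\setminus V(S))\cup\{e(\ell):\ell\in E(S)\}$; it is a $2$-factor of $G$. Going up: let $S$ be an ordered $2$-edge-coloured disjoint union of colour-alternating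 cycles with vertices $s_1<\dots<s_m$, and let $C$ be a component of $S$. The ordered $2$-edge-coloured graph $U(S,C)$ is obtained from a copy of $S$ by adding, for every $s_i\in V(C)$, a new vertex $s_{i+1/2}$; for every red (resp. blue) edge $s_is_j$ of $C$ adding a red (resp. blue) edge $s_{i+1/2}s_{j+1/2}$; and ordering all vertices by their indices. An ordered $2$-edge-coloured graph $U$ is a going-up version of $S$ if for some component $C$ of $S$ there is an order-preserving, colour-preserving isomorphism between $U$ and $U(S,C)$. -}

module Defs where

open import Data.Nat using (ℕ; zero; suc; _≤_; _+_; _*_) renaming (_<_ to _<ℕ_)
open import Data.Nat.DivMod using (_%_; m%n<n)
open import Data.Fin using (Fin; toℕ; fromℕ<; _<_)
open import Data.Product using (Σ; Σ-syntax; _×_; _,_)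
open import Data.Sum using (_⊎_; inj₁; inj₂)
open import Data.Empty using (⊥)
open import Data.Bool using (Bool; true; T)
open import Relation.Nullary using (¬_)
open import Relation.Binary.PropositionalEquality using (_≡_; _≢_)
open import Relation.Binary.Construct.Closure.ReflexiveTransitive using (Star)
open import Function.Bundles using (_⇔_; _↔_)
open import Function.Definitions using (Injective; Surjective)

nxt : ∀ {n} → Fin n → Fin n
nxt {suc n} i = fromℕ< (m%n<n (suc (toℕ i)) (suc n))

-- A graph G on the vertex set Fin n together with a Hamilton cycle
-- H = v 0, v 1, …, v (n-1), v 0 (the paper's v_1 … v_n, shifted to 0-based).

record HamGraph (n : ℕ) : Set₁ where
  field
    E       : Fin n → Fin n → Set
    E-sym   : ∀ {a b} → E a b → E b a
    E-irr   : ∀ {a} → ¬ E a a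
    three≤n : 3 ≤ n
    v       : Fin n → Fin n
    v-inj   : Injective _≡_ _≡_ v
    v-ham   : ∀ i → E (v i) (v (nxt i))

module Aux {n : ℕ} (GH : HamGraph n) where
  open HamGraph GH

  HPair : Fin n → Fin n → Fin n → Set
  HPair i a b = (a ≡ v i × b ≡ v (nxt i)) ⊎ (a ≡ v (nxt i) × b ≡ v i)

  HEdge : Fin n → Fin n → Set
  HEdge a b = Σ[ i ∈ Fin n ] HPair i a b

  Inner : Fin n → Fin n → Set
  Inner a b = E a b × ¬ HEdge a b

  -- The auxiliary graph A(G,H) on {e_i} ≅ Fin n, ordered by Fin order.
  ARed : Fin n → Fin n → Set
  ARed i j = Inner (v (nxt i)) (v (nxt j))

  ABlue : Fin n → Fin n → Set
  ABlue i j = Inner (v i) (v j)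

-- Ordered 2-edge-coloured graphs: vertices Fin m, ordered by Fin order.

record OGraph : Set₁ where
  field
    m        : ℕ
    red      : Fin m → Fin m → Set
    blue     : Fin m → Fin m → Set
    red-sym  : ∀ {x y} → red x y → red y x
    blue-sym : ∀ {x y} → blue x y → blue y x

  Conn : Fin m → Fin m → Set
  Conn = Star (λ x y → red x y ⊎ blue x y)

ExactlyOne : ∀ {m} → (Fin m → Fin m → Set) → Fin m → Set
ExactlyOne R x = Σ[ y ∈ Fin _ ] (R x y × (∀ z → R x z → z ≡ y))

-- disjoint union of colour-alternating cycles: every vertex is incident
-- to exactly one red and exactly one blue edge
IsDUACC : OGraph → Set
IsDUACC S = ∀ x → ExactlyOne red x × ExactlyOne blue x
  where open OGraph S

-- A component of S, given as a Boolean vertex subset: the vertex set of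
-- the connected component of some vertex x₀.
IsComponent : (S : OGraph) → (Fin (OGraph.m S) → Bool) → Set
IsComponent S C = Σ[ x₀ ∈ Fin m ] (∀ y → (C y ≡ true) ⇔ Conn x₀ y)
  where open OGraph S

-- Vertices of U(S,C): inj₁ x is the copy of s_x, inj₂ (x , _) is s_{x+1/2}.
UVert : (S : OGraph) → (Fin (OGraph.m S) → Bool) → Set
UVert S C = Fin m ⊎ Σ[ x ∈ Fin m ] T (C x)
  where open OGraph S

ukey : (S : OGraph) (C : Fin (OGraph.m S) → Bool) → UVert S C → ℕ
ukey S C (inj₁ x)       = 2 * toℕ x
ukey S C (inj₂ (x , _)) = suc (2 * toℕ x)

ured : (S : OGraph) (C : Fin (OGraph.m S) → Bool) → UVert S C → UVert S C → Set
ured S C (inj₁ x)       (inj₁ y)       = OGraph.red S x y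
ured S C (inj₂ (x , _)) (inj₂ (y , _)) = OGraph.red S x y
ured S C _              _              = ⊥

ublue : (S : OGraph) (C : Fin (OGraph.m S) → Bool) → UVert S C → UVert S C → Set
ublue S C (inj₁ x)       (inj₁ y)       = OGraph.blue S x y
ublue S C (inj₂ (x , _)) (inj₂ (y , _)) = OGraph.blue S x y
ublue S C _              _              = ⊥

IsGoingUp : (U S : OGraph) → Set
IsGoingUp U S =
  Σ[ C ∈ (Fin (OGraph.m S) → Bool) ] IsComponent S C ×
  Σ[ φ ∈ (Fin (OGraph.m U) ↔ UVert S C) ]
    ((∀ i j → i < j → ukey S C (Inverse.to φ i) <ℕ ukey S C (Inverse.to φ j))
    × (∀ i j → OGraph.red U i j ⇔ ured S C (Inverse.to φ i) (Inverse.to φ j))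
    × (∀ i j → OGraph.blue U i j ⇔ ublue S C (Inverse.to φ i) (Inverse.to φ j)))
  where open import Function.Bundles using (Inverse)

module Sub {n : ℕ} (GH : HamGraph n) where
  open HamGraph GH
  open Aux GH

  record SubA : Set₁ where
    field
      graph  : OGraph
    open OGraph graph public
    field
      σ      : Fin m → Fin n
      σ-mono : ∀ {x y} → x < y → σ x < σ y
      σ-red  : ∀ {x y} → red x y → ARed (σ x) (σ y)
      σ-blue : ∀ {x y} → blue x y → ABlue (σ x) (σ y)

  NoNeighbouring : SubA → Set
  NoNeighbouring S = ∀ x y → σ y ≢ nxt (σ x)
    where open SubA S

  FEdge : SubA → Fin n → Fin n → Set
  FEdge S a b =
      (Σ[ i ∈ Fin n ] (¬ (Σ[ x ∈ Fin m ] σ x ≡ i)) × HPair i a b)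
    ⊎ (Σ[ x ∈ Fin m ] Σ[ y ∈ Fin m ] red x y × a ≡ v (nxt (σ x)) × b ≡ v (nxt (σ y)))
    ⊎ (Σ[ x ∈ Fin m ] Σ[ y ∈ Fin m ] blue x y × a ≡ v (σ x) × b ≡ v (σ y))
    where open SubA S

  NumComponents : SubA → ℕ → Set
  NumComponents S k =
    Σ[ f ∈ (Fin n → Fin k) ] Surjective _≡_ _≡_ f ×
      (∀ a b → (f a ≡ f b) ⇔ Star (FEdge S) a b)

module Submission where

-- Deleting the edges e_i, i ∈ V(S), from H leaves one path per vertex s_x of S, starting at
-- v_(s_x + 1).  A red edge of S joins the first vertices of two such paths, and a blue edge
-- s_x' s_y' joins v_(s_x') and v_(s_y'), the last vertices of the paths preceding s_x' and s_y'; so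
-- the components of F(S) are those of the graph on V(S) obtained by contracting every path.
-- In U(S,C) each s_x with x ∈ C is followed by s_(x+1/2).  The short path between them meets only
-- the analogous paths of C, through the copies of the edges of C, and these form one new
-- component; the path leaving s_(x+1/2) takes over the role that the path leaving s_x had in F(S).
-- Hence the contracted graph of F(U) is that of F(S) together with one extra connected copy of C.

open import Defs
open import Level using (0ℓ)
open import Data.Nat using (ℕ; zero; suc; _≤_; _<_; z≤n; s≤s; s≤s⁻¹; _+_; _*_; _<?_)
open import Data.Nat.Properties
open import Data.Nat.DivMod using (_%_; m<n⇒m%n≡m; n%n≡0)
open import Data.Nat.Induction using (<-wellFounded)
open import Induction.WellFounded using (Acc; acc)
open import Data.Bool using (Bool; true; false; T)
open import Data.Bool.Properties using (T-irrelevant; T-≡)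
open import Data.Fin as Fin using (Fin; zero; suc; toℕ; fromℕ<; fromℕ; inject₁; punchIn; punchOut)
open import Data.Fin.Properties as Finₚ
  using ( toℕ-fromℕ<; toℕ<n; toℕ-injective; toℕ-fromℕ; toℕ-inject₁; any?; pigeonhole
        ; punchOut-injective; punchInᵢ≢i; punchOut-punchIn; punchOut-cong′; punchOut-cong )
  renaming (_≟_ to _≟ᶠ_)
open import Data.Product using (Σ-syntax; ∃; ∃₂; _×_; _,_; proj₁; proj₂)
open import Data.Sum using (_⊎_; inj₁; inj₂; [_,_]′)
open import Data.Sum.Relation.Binary.Pointwise using (Pointwise; inj₁; inj₂; drop-inj₁)
open import Data.Empty using (⊥-elim)
open import Relation.Nullary using (¬_; Dec; yes; no)
open import Relation.Binary.Core using (Rel)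
open import Relation.Binary.Definitions using (Symmetric)
open import Relation.Binary.PropositionalEquality using (_≡_; _≢_; refl; sym; trans; cong; subst; subst₂; module ≡-Reasoning)
open import Relation.Binary.Construct.Closure.ReflexiveTransitive using (Star; ε; _◅_; _◅◅_; gmap; reverse; kleisliStar)
import Relation.Binary.Reasoning.Setoid as SetoidReasoning
open import Function using (_∘_)
open import Function.Bundles using (_⇔_; mk⇔; Equivalence; Inverse; _↔_)
open import Function.Definitions using (Injective; Surjective; StrictlySurjective)
open import Function.Consequences.Propositional using (surjective⇒strictlySurjective; strictlySurjective⇒surjective)
open import Function.Properties.Equivalence using (⇔-setoid) renaming (sym to ⇔-sym)

-- Connected components

HasComponents : {A : Set} → Rel A 0ℓ → ℕ → Set
HasComponents {A} R k =
  Σ[ f ∈ (A → Fin k) ] Surjective _≡_ _≡_ f × (∀ a b → (f a ≡ f b) ⇔ Star R a b)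

module _ {A B : Set} {R : Rel A 0ℓ} {Q : Rel B 0ℓ} where

  Star-⇔-retraction : Symmetric R → (p : A → B) (s : B → A) →
    (∀ b → p (s b) ≡ b) → (∀ a → Star R (s (p a)) a) →
    (∀ {a a'} → R a a' → Star Q (p a) (p a')) →
    (∀ {b b'} → Q b b' → Star R (s b) (s b')) →
    ∀ a a' → Star R a a' ⇔ Star Q (p a) (p a')
  Star-⇔-retraction R-sym p s ps sp R⇒Q Q⇒R a a' = mk⇔
    (kleisliStar p R⇒Q)
    (λ q → reverse R-sym (sp a) ◅◅ kleisliStar s Q⇒R q ◅◅ sp a')

  HasComponents-surjection : (p : A → B) → (∀ b → ∃ λ a → p a ≡ b) →
    (∀ a a' → Star R a a' ⇔ Star Q (p a) (p a')) →
    ∀ k → HasComponents R k ⇔ HasComponents Q k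
  HasComponents-surjection p p-onto conn k = mk⇔ push pull
    where
    s : B → A
    s = proj₁ ∘ p-onto
    ps : ∀ b → p (s b) ≡ b
    ps = proj₂ ∘ p-onto
    Q-ps : ∀ {b b'} → Star Q (p (s b)) (p (s b')) → Star Q b b'
    Q-ps {b} {b'} = subst₂ (Star Q) (ps b) (ps b')

    push : HasComponents R k → HasComponents Q k
    push (f , f-onto , f-comp) = f ∘ s , strictlySurjective⇒surjective onto , comp
      where
      onto : StrictlySurjective _≡_ (f ∘ s)
      onto y with a , refl ← surjective⇒strictlySurjective f-onto y =
        p a , Equivalence.from (f-comp _ a) (Equivalence.from (conn _ a) (subst (Star Q _) (ps (p a)) ε))
      comp : ∀ b b' → (f (s b) ≡ f (s b')) ⇔ Star Q b b'
      comp b b' = mk⇔ (Q-ps ∘ Equivalence.to (conn _ _) ∘ Equivalence.to (f-comp _ _))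
        (Equivalence.from (f-comp _ _) ∘ Equivalence.from (conn _ _) ∘ subst₂ (Star Q) (sym (ps b)) (sym (ps b')))

    pull : HasComponents Q k → HasComponents R k
    pull (g , g-onto , g-comp) = g ∘ p , strictlySurjective⇒surjective onto , comp
      where
      onto : StrictlySurjective _≡_ (g ∘ p)
      onto y with b , refl ← surjective⇒strictlySurjective g-onto y = s b , cong g (ps b)
      comp : ∀ a a' → (g (p a) ≡ g (p a')) ⇔ Star R a a'
      comp a a' = mk⇔ (Equivalence.from (conn a a') ∘ Equivalence.to (g-comp _ _))
                      (Equivalence.from (g-comp _ _) ∘ Equivalence.to (conn a a'))

module _ {B D : Set} {Q : Rel B 0ℓ} {P : Rel D 0ℓ} where

  Star-Pointwise : ∀ {x y} → Star (Pointwise Q P) x y → Pointwise (Star Q) (Star P) x y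
  Star-Pointwise {inj₁ _} ε = inj₁ ε
  Star-Pointwise {inj₂ _} ε = inj₂ ε
  Star-Pointwise (inj₁ q ◅ qs) with inj₁ r ← Star-Pointwise qs = inj₁ (q ◅ r)
  Star-Pointwise (inj₂ p ◅ ps) with inj₂ r ← Star-Pointwise ps = inj₂ (p ◅ r)

  Star-inj₁ : ∀ {b b'} → Star Q b b' → Star (Pointwise Q P) (inj₁ b) (inj₁ b')
  Star-inj₁ = gmap inj₁ inj₁

  Star-inj₂ : ∀ {d d'} → Star P d d' → Star (Pointwise Q P) (inj₂ d) (inj₂ d')
  Star-inj₂ = gmap inj₂ inj₂

  ¬Star-inj₁-inj₂ : ∀ {b d} → ¬ Star (Pointwise Q P) (inj₁ b) (inj₂ d)
  ¬Star-inj₁-inj₂ q with () ← Star-Pointwise q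

  ¬Star-inj₂-inj₁ : ∀ {b d} → ¬ Star (Pointwise Q P) (inj₂ d) (inj₁ b)
  ¬Star-inj₂-inj₁ q with () ← Star-Pointwise q

  HasComponents-⊎-connected : Symmetric P → (d₀ : D) → (∀ d → Star P d₀ d) →
    ∀ k → HasComponents Q k ⇔ HasComponents (Pointwise Q P) (suc k)
  HasComponents-⊎-connected P-sym d₀ d₀-conn k = mk⇔ extend restrict
    where
    D-conn : ∀ d d' → Star (Pointwise Q P) (inj₂ d) (inj₂ d')
    D-conn d d' = Star-inj₂ (reverse P-sym (d₀-conn d) ◅◅ d₀-conn d')

    extend : HasComponents Q k → HasComponents (Pointwise Q P) (suc k)
    extend (f , f-onto , f-comp) = f′ , strictlySurjective⇒surjective onto , comp
      where
      f′ : B ⊎ D → Fin (suc k)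
      f′ (inj₁ b) = suc (f b)
      f′ (inj₂ _) = zero
      onto : StrictlySurjective _≡_ f′
      onto zero = inj₂ d₀ , refl
      onto (suc y) with b , refl ← surjective⇒strictlySurjective f-onto y = inj₁ b , refl
      comp : ∀ x y → (f′ x ≡ f′ y) ⇔ Star (Pointwise Q P) x y
      comp (inj₁ b) (inj₁ b') = mk⇔ (Star-inj₁ ∘ Equivalence.to (f-comp b b') ∘ Finₚ.suc-injective)
                                    (cong suc ∘ Equivalence.from (f-comp b b') ∘ drop-inj₁ ∘ Star-Pointwise)
      comp (inj₁ b) (inj₂ d)  = mk⇔ (λ ()) (⊥-elim ∘ ¬Star-inj₁-inj₂)
      comp (inj₂ d) (inj₁ b)  = mk⇔ (λ ()) (⊥-elim ∘ ¬Star-inj₂-inj₁)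
      comp (inj₂ d) (inj₂ d') = mk⇔ (λ _ → D-conn d d') (λ _ → refl)

    restrict : HasComponents (Pointwise Q P) (suc k) → HasComponents Q k
    restrict (g , g-onto , g-comp) = f , strictlySurjective⇒surjective onto , comp
      where
      c₀ : Fin (suc k)
      c₀ = g (inj₂ d₀)
      c₀≢ : ∀ b → c₀ ≢ g (inj₁ b)
      c₀≢ b = ¬Star-inj₂-inj₁ ∘ Equivalence.to (g-comp _ _)
      f : B → Fin k
      f b = punchOut (c₀≢ b)
      onto : StrictlySurjective _≡_ f
      onto y with surjective⇒strictlySurjective g-onto (punchIn c₀ y)
      ... | inj₁ b , e = b , trans (punchOut-cong′ c₀ e) (punchOut-punchIn c₀)
      ... | inj₂ d , e = ⊥-elim (punchInᵢ≢i c₀ y (trans (sym e) (Equivalence.from (g-comp _ _) (D-conn d d₀))))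
      comp : ∀ b b' → (f b ≡ f b') ⇔ Star Q b b'
      comp b b' = mk⇔
        (drop-inj₁ ∘ Star-Pointwise ∘ Equivalence.to (g-comp _ _) ∘ punchOut-injective (c₀≢ b) (c₀≢ b'))
                      (punchOut-cong c₀ ∘ Equivalence.from (g-comp _ _) ∘ Star-inj₁)

-- Cyclic indices and strictly monotone maps on Fin

toℕ-nxt : ∀ {n} (i : Fin n) → (suc (toℕ i) ≡ n × toℕ (nxt i) ≡ 0) ⊎ (toℕ (nxt i) ≡ suc (toℕ i))
toℕ-nxt {suc n} i with m≤n⇒m<n∨m≡n (toℕ<n i)
... | inj₁ lt = inj₂ (trans (toℕ-fromℕ< _) (m<n⇒m%n≡m lt))
... | inj₂ eq = inj₁ (eq , trans (toℕ-fromℕ< _) (trans (cong (_% suc n) eq) (n%n≡0 (suc n))))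

prev : ∀ {n} → Fin n → Fin n
prev {suc n} zero    = fromℕ n
prev {suc n} (suc i) = inject₁ i

CyclicPred : ∀ {m} → ℕ → Fin m → Set
CyclicPred {m} c x = (c ≡ 0 × suc (toℕ x) ≡ m) ⊎ suc (toℕ x) ≡ c

CyclicPred-unique : ∀ {m c} {x y : Fin m} → CyclicPred c x → CyclicPred c y → x ≡ y
CyclicPred-unique (inj₁ (_ , x-last)) (inj₁ (_ , y-last)) = toℕ-injective (suc-injective (trans x-last (sym y-last)))
CyclicPred-unique (inj₂ x<c)          (inj₂ y<c)          = toℕ-injective (suc-injective (trans x<c (sym y<c)))
CyclicPred-unique (inj₁ (refl , _))   (inj₂ ())
CyclicPred-unique (inj₂ ())           (inj₁ (refl , _))

toℕ-prev : ∀ {n} (j : Fin n) → CyclicPred (toℕ j) (prev j)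
toℕ-prev {suc n} zero    = inj₁ (refl , cong suc (toℕ-fromℕ n))
toℕ-prev {suc n} (suc i) = inj₂ (cong suc (toℕ-inject₁ i))

cyclicPred : ∀ {m} (c : ℕ) → c ≤ m → 0 < m → Fin m
cyclicPred {suc m} zero    _   _ = fromℕ m
cyclicPred {suc m} (suc c) c<m _ = fromℕ< c<m

cyclicPred-spec : ∀ {m} c (c≤m : c ≤ m) (0<m : 0 < m) → CyclicPred c (cyclicPred c c≤m 0<m)
cyclicPred-spec {suc m} zero    _   _ = inj₁ (refl , cong suc (toℕ-fromℕ m))
cyclicPred-spec {suc m} (suc c) c<m _ = inj₂ (cong suc (toℕ-fromℕ< c<m))

nxt-prev : ∀ {n} (j : Fin n) → nxt (prev j) ≡ j
nxt-prev j with toℕ-prev j | toℕ-nxt (prev j)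
... | inj₁ (j≡0 , _)   | inj₁ (_ , nxt≡0) = toℕ-injective (trans nxt≡0 (sym j≡0))
... | inj₂ prev<j      | inj₂ nxt≡       = toℕ-injective (trans nxt≡ prev<j)
... | inj₁ (_ , last)  | inj₂ nxt≡       = ⊥-elim (<-irrefl last (subst (_< _) nxt≡ (toℕ<n _)))
... | inj₂ prev<j      | inj₁ (last , _) = ⊥-elim (<-irrefl last (subst (_< _) (sym prev<j) (toℕ<n j)))

injective⇒strictlySurjective : ∀ {n} (f : Fin n → Fin n) → Injective _≡_ _≡_ f → StrictlySurjective _≡_ f
injective⇒strictlySurjective {suc n} f f-inj a with any? (λ i → f i ≟ᶠ a)
... | yes hit = hit
... | no miss = ⊥-elim (collision (pigeonhole ≤-refl (λ i → punchOut (missed i))))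
  where
  missed : ∀ i → a ≢ f i
  missed i = miss ∘ (i ,_) ∘ sym
  collision : ¬ ∃₂ λ i j → i Fin.< j × punchOut (missed i) ≡ punchOut (missed j)
  collision (i , j , i<j , eq) = <-irrefl (cong toℕ (f-inj (punchOut-injective (missed i) (missed j) eq))) i<j

DownwardClosed : ∀ {m} → (Fin m → Set) → Set
DownwardClosed P = ∀ {x y} → toℕ y ≤ toℕ x → P x → P y

downwardClosed⇒prefix : ∀ {m} (P : Fin m → Set) → (∀ y → Dec (P y)) → DownwardClosed P →
  Σ[ c ∈ ℕ ] c ≤ m × (∀ y → P y ⇔ toℕ y < c)
downwardClosed⇒prefix {zero}  P P? closed = 0 , z≤n , λ ()
downwardClosed⇒prefix {suc m} P P? closed with P? zero
... | no ¬P0 = 0 , z≤n , λ y → mk⇔ (λ Py → ⊥-elim (¬P0 (closed z≤n Py))) (λ ())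
... | yes P0 with c , c≤m , spec ← downwardClosed⇒prefix (P ∘ suc) (P? ∘ suc) (closed ∘ s≤s) =
  suc c , s≤s c≤m , λ { zero → mk⇔ (λ _ → s≤s z≤n) (λ _ → P0)
                      ; (suc y) → mk⇔ (s≤s ∘ Equivalence.to (spec y)) (Equivalence.from (spec y) ∘ s≤s⁻¹) }

prefix-mono : ∀ {m} c c' → c ≤ m → (∀ (y : Fin m) → toℕ y < c → toℕ y < c') → c ≤ c'
prefix-mono c c' c≤m incl = ≮⇒≥ λ c'<c →
  let y = fromℕ< (<-≤-trans c'<c c≤m) in
  <-irrefl (toℕ-fromℕ< _) (incl y (subst (_< c) (sym (toℕ-fromℕ< _)) c'<c))

prefix-unique : ∀ {m} c c' → c ≤ m → c' ≤ m → (∀ (y : Fin m) → toℕ y < c ⇔ toℕ y < c') → c ≡ c'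
prefix-unique c c' c≤m c'≤m same =
  ≤-antisym (prefix-mono c c' c≤m (Equivalence.to ∘ same)) (prefix-mono c' c c'≤m (Equivalence.from ∘ same))

module StrictlyMonotone {m} (f : Fin m → ℕ) (f-mono : ∀ {x y} → x Fin.< y → f x < f y) where

  mono-≤ : ∀ {x y} → toℕ x ≤ toℕ y → f x ≤ f y
  mono-≤ {x} {y} x≤y with m≤n⇒m<n∨m≡n x≤y
  ... | inj₁ x<y = <⇒≤ (f-mono x<y)
  ... | inj₂ x≡y = ≤-reflexive (cong f (toℕ-injective x≡y))

  cancel-< : ∀ {x y} → f x < f y → toℕ x < toℕ y
  cancel-< fx<fy = ≰⇒> (<⇒≱ fx<fy ∘ mono-≤)

  cancel-≤ : ∀ {x y} → f x ≤ f y → toℕ x ≤ toℕ y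
  cancel-≤ fx≤fy = ≮⇒≥ (λ y<x → <⇒≱ (f-mono y<x) fx≤fy)

  injective : ∀ {x y} → f x ≡ f y → x ≡ y
  injective fx≡fy =
    toℕ-injective (≤-antisym (cancel-≤ (≤-reflexive fx≡fy)) (cancel-≤ (≤-reflexive (sym fx≡fy))))

  prev-greatest : ∀ {i j} → f j < f i → (∀ l → f l < f i → f l ≤ f j) → prev i ≡ j
  prev-greatest {i} {j} fj<fi greatest with toℕ-prev i
  ... | inj₁ (i≡0 , _) = ⊥-elim (n≮0 (subst (toℕ j <_) i≡0 (cancel-< fj<fi)))
  ... | inj₂ prev<i    = injective (≤-antisym (greatest (prev i) (f-mono (≤-reflexive prev<i)))
                                              (mono-≤ (s≤s⁻¹ (subst (toℕ j <_) (sym prev<i) (cancel-< fj<fi)))))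

  prev-least : ∀ {i j} → (∀ l → f i ≤ f l) → (∀ l → f l ≤ f j) → prev i ≡ j
  prev-least {i} {j} least greatest with toℕ-prev i
  ... | inj₁ (_ , prev-last) = injective (≤-antisym (greatest (prev i))
                                                   (mono-≤ (s≤s⁻¹ (subst (toℕ j <_) (sym prev-last) (toℕ<n j)))))
  ... | inj₂ prev<i          = ⊥-elim (<⇒≱ (f-mono (≤-reflexive prev<i)) (least (prev i)))

-- Cutting H at the vertices of a subgraph of A

module Segments {n} (GH : HamGraph n) (S : Sub.SubA GH) (0<m : 0 < Sub.SubA.m S) where
  open HamGraph GH
  open Sub GH
  open SubA S
  open StrictlyMonotone (toℕ ∘ σ) σ-mono

  position : Fin n → Fin n
  position = proj₁ ∘ injective⇒strictlySurjective v v-inj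

  v-position : ∀ a → v (position a) ≡ a
  v-position = proj₂ ∘ injective⇒strictlySurjective v v-inj

  position-v : ∀ j → position (v j) ≡ j
  position-v j = v-inj (v-position (v j))

  Cut : Fin n → Set
  Cut j = Σ[ x ∈ Fin m ] σ x ≡ j

  #cutsBelow-prefix : ∀ t → Σ[ c ∈ ℕ ] c ≤ m × (∀ y → toℕ (σ y) < t ⇔ toℕ y < c)
  #cutsBelow-prefix t = downwardClosed⇒prefix _ (λ y → toℕ (σ y) <? t) (λ y≤x → ≤-<-trans (mono-≤ y≤x))

  #cutsBelow : ℕ → ℕ
  #cutsBelow = proj₁ ∘ #cutsBelow-prefix

  #cutsBelow≤m : ∀ t → #cutsBelow t ≤ m
  #cutsBelow≤m = proj₁ ∘ proj₂ ∘ #cutsBelow-prefix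

  #cutsBelow-spec : ∀ t y → toℕ (σ y) < t ⇔ toℕ y < #cutsBelow t
  #cutsBelow-spec = proj₂ ∘ proj₂ ∘ #cutsBelow-prefix

  #cutsBelow-unique : ∀ t c → c ≤ m → (∀ y → toℕ (σ y) < t ⇔ toℕ y < c) → #cutsBelow t ≡ c
  #cutsBelow-unique t c c≤m spec = prefix-unique _ c (#cutsBelow≤m t) c≤m λ y →
    mk⇔ (Equivalence.to (spec y) ∘ Equivalence.from (#cutsBelow-spec t y))
        (Equivalence.to (#cutsBelow-spec t y) ∘ Equivalence.from (spec y))

  #cutsBelow-0 : #cutsBelow 0 ≡ 0
  #cutsBelow-0 = #cutsBelow-unique 0 0 z≤n λ y → mk⇔ (λ ()) (λ ())

  #cutsBelow-n : #cutsBelow n ≡ m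
  #cutsBelow-n = #cutsBelow-unique n m ≤-refl λ y → mk⇔ (λ _ → toℕ<n y) (λ _ → toℕ<n (σ y))

  #cutsBelow-σ : ∀ x → #cutsBelow (toℕ (σ x)) ≡ toℕ x
  #cutsBelow-σ x = #cutsBelow-unique _ _ (<⇒≤ (toℕ<n x)) λ y → mk⇔ cancel-< σ-mono

  #cutsBelow-suc-σ : ∀ x → #cutsBelow (suc (toℕ (σ x))) ≡ suc (toℕ x)
  #cutsBelow-suc-σ x = #cutsBelow-unique _ _ (toℕ<n x) λ y →
    mk⇔ (s≤s ∘ cancel-≤ ∘ s≤s⁻¹) (s≤s ∘ mono-≤ ∘ s≤s⁻¹)

  #cutsBelow-suc : ∀ j → ¬ Cut j → #cutsBelow (suc (toℕ j)) ≡ #cutsBelow (toℕ j)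
  #cutsBelow-suc j uncut = #cutsBelow-unique _ _ (#cutsBelow≤m _) λ y →
    mk⇔ (Equivalence.to (#cutsBelow-spec _ y) ∘ strict y) (m<n⇒m<1+n ∘ Equivalence.from (#cutsBelow-spec _ y))
    where
    strict : ∀ y → toℕ (σ y) < suc (toℕ j) → toℕ (σ y) < toℕ j
    strict y σy≤j = ≤∧≢⇒< (s≤s⁻¹ σy≤j) (uncut ∘ (y ,_) ∘ toℕ-injective)

  -- v j lies on the path starting at v (nxt (σ (segment j))): the cuts before position j number
  -- #cutsBelow j, and segment j is the last of them, cyclically.
  segment : Fin n → Fin m
  segment j = cyclicPred (#cutsBelow (toℕ j)) (#cutsBelow≤m _) 0<m

  segment-spec : ∀ j → CyclicPred (#cutsBelow (toℕ j)) (segment j)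
  segment-spec j = cyclicPred-spec _ _ _

  segment-unique : ∀ j {x} → CyclicPred (#cutsBelow (toℕ j)) x → segment j ≡ x
  segment-unique j = CyclicPred-unique (segment-spec j)

  segment-σ : ∀ x → segment (σ x) ≡ prev x
  segment-σ x = segment-unique (σ x) (subst (λ c → CyclicPred c (prev x)) (sym (#cutsBelow-σ x)) (toℕ-prev x))

  segment-nxt-σ : ∀ x → segment (nxt (σ x)) ≡ x
  segment-nxt-σ x with toℕ-nxt (σ x)
  ... | inj₁ (σx-last , nxt≡0) = segment-unique _ (inj₁ (trans (cong #cutsBelow nxt≡0) #cutsBelow-0 ,
          trans (sym (#cutsBelow-suc-σ x)) (trans (cong #cutsBelow σx-last) #cutsBelow-n)))
  ... | inj₂ nxt≡ = segment-unique _ (inj₂ (sym (trans (cong #cutsBelow nxt≡) (#cutsBelow-suc-σ x))))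

  segment-nxt : ∀ j → ¬ Cut j → segment (nxt j) ≡ segment j
  segment-nxt j uncut with toℕ-nxt j | segment-spec j
  ... | inj₂ nxt≡ | spec = segment-unique _ (subst (λ c → CyclicPred c (segment j))
          (sym (trans (cong #cutsBelow nxt≡) (#cutsBelow-suc j uncut))) spec)
  ... | inj₁ (j-last , nxt≡0) | spec =
    segment-unique _ (inj₁ (trans (cong #cutsBelow nxt≡0) #cutsBelow-0 , last spec))
    where
    all-below : #cutsBelow (toℕ j) ≡ m
    all-below = trans (sym (#cutsBelow-suc j uncut)) (trans (cong #cutsBelow j-last) #cutsBelow-n)
    last : CyclicPred (#cutsBelow (toℕ j)) (segment j) → suc (toℕ (segment j)) ≡ m
    last (inj₁ (_ , seg-last)) = seg-last
    last (inj₂ seg<c)          = trans seg<c all-below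

  lastVertex : Fin m
  lastVertex = cyclicPred 0 z≤n 0<m

  lastCut : ℕ
  lastCut = toℕ (σ lastVertex)

  -- Positions on H read from the vertex after the last cut; stepping back from v j towards the
  -- start of its path decreases it (unroll-prev), which is the termination measure of start⇝.
  unroll : ℕ → ℕ
  unroll t with lastCut <? t
  ... | yes _ = t
  ... | no _  = t + n

  unroll-above : ∀ {t} → lastCut < t → unroll t ≡ t
  unroll-above {t} above with lastCut <? t
  ... | yes _ = refl
  ... | no below = ⊥-elim (below above)

  unroll-below : ∀ {t} → t ≤ lastCut → unroll t ≡ t + n
  unroll-below {t} below with lastCut <? t
  ... | yes above = ⊥-elim (<⇒≱ above below)
  ... | no _ = refl

  lastCut≢ : ∀ {j} → ¬ Cut j → lastCut ≢ toℕ j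
  lastCut≢ uncut = uncut ∘ (_ ,_) ∘ toℕ-injective

  unroll-prev : ∀ j → ¬ Cut (prev j) → unroll (toℕ (prev j)) < unroll (toℕ j)
  unroll-prev j uncut with toℕ-prev j | ≤-<-connex (toℕ (prev j)) lastCut
  ... | inj₁ (j≡0 , _) | inj₂ above = begin-strict
    unroll (toℕ (prev j)) ≡⟨ unroll-above above ⟩
    toℕ (prev j)          <⟨ toℕ<n (prev j) ⟩
    n                     ≤⟨ m≤n+m n (toℕ j) ⟩
    toℕ j + n             ≡⟨ sym (unroll-below (subst (_≤ lastCut) (sym j≡0) z≤n)) ⟩
    unroll (toℕ j)        ∎
    where open ≤-Reasoning
  ... | inj₁ (_ , prev-last) | inj₁ below = ⊥-elim (lastCut≢ uncut (≤-antisym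
        (s≤s⁻¹ (subst (lastCut <_) (sym prev-last) (toℕ<n (σ _)))) below))
  ... | inj₂ prev<j | inj₂ above = begin-strict
    unroll (toℕ (prev j)) ≡⟨ unroll-above above ⟩
    toℕ (prev j)          <⟨ ≤-reflexive prev<j ⟩
    toℕ j                 ≡⟨ sym (unroll-above (<-trans above (≤-reflexive prev<j))) ⟩
    unroll (toℕ j)        ∎
    where open ≤-Reasoning
  ... | inj₂ prev<j | inj₁ below = begin-strict
    unroll (toℕ (prev j)) ≡⟨ unroll-below below ⟩
    toℕ (prev j) + n      <⟨ +-monoˡ-< n (≤-reflexive prev<j) ⟩
    toℕ j + n             ≡⟨ sym (unroll-below (subst (_≤ lastCut) prev<j (≤∧≢⇒< below (lastCut≢ uncut ∘ sym)))) ⟩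
    unroll (toℕ j)        ∎
    where open ≤-Reasoning

  start : Fin m → Fin n
  start x = v (nxt (σ x))

  hamiltonEdge : ∀ i → ¬ Cut i → FEdge S (v i) (v (nxt i))
  hamiltonEdge i uncut = inj₁ (i , uncut , inj₁ (refl , refl))

  start⇝ : ∀ j → Star (FEdge S) (start (segment j)) (v j)
  start⇝ j = go j (<-wellFounded (unroll (toℕ j)))
    where
    go : ∀ j → Acc _<_ (unroll (toℕ j)) → Star (FEdge S) (start (segment j)) (v j)
    go j (acc smaller) with any? (λ x → σ x ≟ᶠ prev j)
    ... | yes (x , σx≡prev) = subst (λ a → Star (FEdge S) a (v j)) (sym start≡vj) ε
      where
      nxtσx≡j : nxt (σ x) ≡ j
      nxtσx≡j = trans (cong nxt σx≡prev) (nxt-prev j)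
      start≡vj : start (segment j) ≡ v j
      start≡vj = begin
        start (segment j)             ≡⟨ cong (start ∘ segment) (sym nxtσx≡j) ⟩
        start (segment (nxt (σ x)))   ≡⟨ cong start (segment-nxt-σ x) ⟩
        start x                       ≡⟨ cong v nxtσx≡j ⟩
        v j                           ∎
        where open ≡-Reasoning
    ... | no uncut = subst₂ (Star (FEdge S)) (cong start same-segment) refl (go (prev j) (smaller (unroll-prev j uncut)))
                     ◅◅ subst (FEdge S (v (prev j))) (cong v (nxt-prev j)) (hamiltonEdge (prev j) uncut) ◅ ε
      where
      same-segment : segment (prev j) ≡ segment j
      same-segment = trans (sym (segment-nxt (prev j) uncut)) (cong segment (nxt-prev j))

  -- A red edge x y of S joins the first vertices of the paths x and y; a blue edge x' y' joins
  -- v (σ x') and v (σ y'), the last vertices of the paths prev x' and prev y'.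
  SegmentAdj : Fin m → Fin m → Set
  SegmentAdj x y = red x y ⊎ Σ[ x' ∈ Fin m ] Σ[ y' ∈ Fin m ] blue x' y' × prev x' ≡ x × prev y' ≡ y

  FEdge-sym : Symmetric (FEdge S)
  FEdge-sym (inj₁ (i , uncut , inj₁ (a≡ , b≡)))      = inj₁ (i , uncut , inj₂ (b≡ , a≡))
  FEdge-sym (inj₁ (i , uncut , inj₂ (a≡ , b≡)))      = inj₁ (i , uncut , inj₁ (b≡ , a≡))
  FEdge-sym (inj₂ (inj₁ (x , y , r , a≡ , b≡)))      = inj₂ (inj₁ (y , x , red-sym r , b≡ , a≡))
  FEdge-sym (inj₂ (inj₂ (x , y , b , a≡ , b≡)))      = inj₂ (inj₂ (y , x , blue-sym b , b≡ , a≡))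

  segmentOf : Fin n → Fin m
  segmentOf = segment ∘ position

  segmentOf-start : ∀ x → segmentOf (start x) ≡ x
  segmentOf-start x = trans (cong segment (position-v _)) (segment-nxt-σ x)

  segmentOf-v : ∀ j → segmentOf (v j) ≡ segment j
  segmentOf-v = cong segment ∘ position-v

  segmentOf-hamiltonEdge : ∀ i → ¬ Cut i → segmentOf (v (nxt i)) ≡ segmentOf (v i)
  segmentOf-hamiltonEdge i uncut = trans (segmentOf-v _) (trans (segment-nxt i uncut) (sym (segmentOf-v i)))

  FEdge⇒SegmentAdj : ∀ {a b} → FEdge S a b → Star SegmentAdj (segmentOf a) (segmentOf b)
  FEdge⇒SegmentAdj (inj₁ (i , uncut , inj₁ (refl , refl))) =
    subst (Star SegmentAdj _) (sym (segmentOf-hamiltonEdge i uncut)) ε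
  FEdge⇒SegmentAdj (inj₁ (i , uncut , inj₂ (refl , refl))) =
    subst (Star SegmentAdj _) (segmentOf-hamiltonEdge i uncut) ε
  FEdge⇒SegmentAdj (inj₂ (inj₁ (x , y , r , refl , refl))) =
    subst₂ (Star SegmentAdj) (sym (segmentOf-start x)) (sym (segmentOf-start y)) (inj₁ r ◅ ε)
  FEdge⇒SegmentAdj (inj₂ (inj₂ (x , y , b , refl , refl))) =
    subst₂ (Star SegmentAdj) (sym (trans (segmentOf-v _) (segment-σ x))) (sym (trans (segmentOf-v _) (segment-σ y)))
      (inj₂ (x , y , b , refl , refl) ◅ ε)

  start⇝σ : ∀ {x' x} → prev x' ≡ x → Star (FEdge S) (start x) (v (σ x'))
  start⇝σ {x'} refl = subst (λ z → Star (FEdge S) (start z) (v (σ x'))) (segment-σ x') (start⇝ (σ x'))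

  SegmentAdj⇒FEdge : ∀ {x y} → SegmentAdj x y → Star (FEdge S) (start x) (start y)
  SegmentAdj⇒FEdge {x} {y} (inj₁ r) = inj₂ (inj₁ (x , y , r , refl , refl)) ◅ ε
  SegmentAdj⇒FEdge (inj₂ (x' , y' , b , x'↦x , y'↦y)) =
    start⇝σ x'↦x ◅◅ inj₂ (inj₂ (x' , y' , b , refl , refl)) ◅ reverse FEdge-sym (start⇝σ y'↦y)

  start-segmentOf⇝ : ∀ a → Star (FEdge S) (start (segmentOf a)) a
  start-segmentOf⇝ a = subst (Star (FEdge S) _) (v-position a) (start⇝ (position a))

  components-F≃SegmentAdj : ∀ k → NumComponents S k ⇔ HasComponents SegmentAdj k
  components-F≃SegmentAdj = HasComponents-surjection segmentOf (λ x → start x , segmentOf-start x)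
    (Star-⇔-retraction FEdge-sym segmentOf start segmentOf-start start-segmentOf⇝
      FEdge⇒SegmentAdj SegmentAdj⇒FEdge)

  SegmentAdj-sym : Symmetric SegmentAdj
  SegmentAdj-sym (inj₁ r)                          = inj₁ (red-sym r)
  SegmentAdj-sym (inj₂ (x' , y' , b , x'↦ , y'↦)) = inj₂ (y' , x' , blue-sym b , y'↦ , x'↦)

-- Going up

module GoingUp {n} (GH : HamGraph n) (S U : Sub.SubA GH)
  (C : Fin (Sub.SubA.m S) → Bool) (x₀ : Fin (Sub.SubA.m S))
  (C-comp : ∀ y → (C y ≡ true) ⇔ OGraph.Conn (Sub.SubA.graph S) x₀ y)
  (φ : Fin (Sub.SubA.m U) ↔ UVert (Sub.SubA.graph S) C)
  (φ-mono : ∀ i j → i Fin.< j →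
    ukey (Sub.SubA.graph S) C (Inverse.to φ i) < ukey (Sub.SubA.graph S) C (Inverse.to φ j))
  (φ-red : ∀ i j →
    OGraph.red (Sub.SubA.graph U) i j ⇔ ured (Sub.SubA.graph S) C (Inverse.to φ i) (Inverse.to φ j))
  (φ-blue : ∀ i j →
    OGraph.blue (Sub.SubA.graph U) i j ⇔ ublue (Sub.SubA.graph S) C (Inverse.to φ i) (Inverse.to φ j))
  where

  open Sub GH
  module S = SubA S
  module U = SubA U
  open Inverse φ using (to; from)

  UV : Set
  UV = UVert S.graph C

  key : UV → ℕ
  key = ukey S.graph C

  to-from : ∀ u → to (from u) ≡ u
  to-from u = Inverse.strictlyInverseˡ φ u

  from-to : ∀ i → from (to i) ≡ i
  from-to i = Inverse.strictlyInverseʳ φ i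

  index : UV → Fin S.m
  index (inj₁ x)       = x
  index (inj₂ (x , _)) = x

  key-lower : ∀ u → 2 * toℕ (index u) ≤ key u
  key-lower (inj₁ _) = ≤-refl
  key-lower (inj₂ _) = n≤1+n _

  key-upper : ∀ u → key u ≤ suc (2 * toℕ (index u))
  key-upper (inj₁ _) = n≤1+n _
  key-upper (inj₂ _) = ≤-refl

  odd<even : ∀ {a b} → a < b → suc (2 * a) < 2 * b
  odd<even {a} {b} a<b = subst (_≤ 2 * b) (*-suc 2 a) (*-monoʳ-≤ 2 a<b)

  -- Unlike T? (C x), this decision does not reduce to a record, so 'with inC? x' abstracts it.
  inC? : ∀ x → T (C x) ⊎ ¬ T (C x)
  inC? x with C x
  ... | true  = inj₁ _
  ... | false = inj₂ λ ()

  -- s_(x+1/2) if x ∈ C and s_x otherwise: the last vertex of U(S,C) with index x.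
  top : Fin S.m → UV
  top x with inC? x
  ... | inj₁ c = inj₂ (x , c)
  ... | inj₂ _ = inj₁ x

  index-top : ∀ x → index (top x) ≡ x
  index-top x with inC? x
  ... | inj₁ _ = refl
  ... | inj₂ _ = refl

  top-inC : ∀ x (c : T (C x)) → top x ≡ inj₂ (x , c)
  top-inC x c with inC? x
  ... | inj₁ c' = cong (λ c → inj₂ (x , c)) (T-irrelevant c' c)
  ... | inj₂ ¬c = ⊥-elim (¬c c)

  top-notC : ∀ x → ¬ T (C x) → top x ≡ inj₁ x
  top-notC x ¬c with inC? x
  ... | inj₁ c = ⊥-elim (¬c c)
  ... | inj₂ _ = refl

  key-top-lower : ∀ x → 2 * toℕ x ≤ key (top x)
  key-top-lower x = subst (λ z → 2 * toℕ z ≤ key (top x)) (index-top x) (key-lower (top x))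

  key-top-upper : ∀ x → key (top x) ≤ suc (2 * toℕ x)
  key-top-upper x = subst (λ z → key (top x) ≤ suc (2 * toℕ z)) (index-top x) (key-upper (top x))

  key≤key-top : ∀ u x → toℕ (index u) ≤ toℕ x → key u ≤ key (top x)
  key≤key-top (inj₂ (y , c)) x y≤x with m≤n⇒m<n∨m≡n y≤x
  ... | inj₂ y≡x rewrite toℕ-injective y≡x | top-inC x c = ≤-refl
  ... | inj₁ y<x = ≤-trans (<⇒≤ (odd<even y<x)) (key-top-lower x)
  key≤key-top (inj₁ y) x y≤x = ≤-trans (*-monoʳ-≤ 2 y≤x) (key-top-lower x)

  K : Fin U.m → ℕ
  K = key ∘ to

  module K-order = StrictlyMonotone K (φ-mono _ _)

  key-from : ∀ u → K (from u) ≡ key u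
  key-from = cong key ∘ to-from

  to-prev-greatest : ∀ {i u} → key u < K i → (∀ l → K l < K i → K l ≤ key u) → to (prev i) ≡ u
  to-prev-greatest {i} {u} u<i greatest = trans (cong to (K-order.prev-greatest
    (subst (_< K i) (sym (key-from u)) u<i) (λ l l<i → subst (K l ≤_) (sym (key-from u)) (greatest l l<i)))) (to-from u)

  to-prev-least : ∀ {i u} → (∀ l → K i ≤ K l) → (∀ l → K l ≤ key u) → to (prev i) ≡ u
  to-prev-least {i} {u} least greatest = trans (cong to (K-order.prev-least least
    (λ l → subst (K l ≤_) (sym (key-from u)) (greatest l)))) (to-from u)

  to-prev-new : ∀ {i x c} → to i ≡ inj₂ (x , c) → to (prev i) ≡ inj₁ x
  to-prev-new to-i =
    to-prev-greatest (≤-reflexive (sym (cong key to-i))) (λ l → s≤s⁻¹ ∘ subst (K l <_) (cong key to-i))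

  to-prev-old : ∀ {i x} → to i ≡ inj₁ x → to (prev i) ≡ top (prev x)
  to-prev-old {i} {x} to-i with toℕ-prev x
  ... | inj₁ (x≡0 , prev-last) = to-prev-least
          (λ l → subst (_≤ K l) (sym (trans (cong key to-i) (cong (2 *_) x≡0))) z≤n)
          (λ l → key≤key-top (to l) (prev x) (s≤s⁻¹ (subst (toℕ (index (to l)) <_) (sym prev-last) (toℕ<n _))))
  ... | inj₂ prev<x = to-prev-greatest
          (subst (key (top (prev x)) <_) (sym (trans (cong key to-i) (cong (2 *_) (sym prev<x))))
                 (≤-<-trans (key-top-upper (prev x)) (odd<even (n<1+n _))))
          (λ l l<i → key≤key-top (to l) (prev x) (s≤s⁻¹ (subst (toℕ (index (to l)) <_) (sym prev<x)
                       (*-cancelˡ-< 2 _ _ (≤-<-trans (key-lower (to l)) (subst (K l <_) (cong key to-i) l<i))))))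

  InC : Set
  InC = Σ[ x ∈ Fin S.m ] T (C x)

  -- Paths of F(U) are indexed by the vertices of U(S,C).  The path leaving the copy of s_x with
  -- x ∈ C goes to the new component; every other path goes to the path of F(S) it replaces.
  split : UV → Fin S.m ⊎ InC
  split (inj₁ x) with inC? x
  ... | inj₁ c = inj₂ (x , c)
  ... | inj₂ _ = inj₁ x
  split (inj₂ (x , _)) = inj₁ x

  merge : Fin S.m ⊎ InC → UV
  merge (inj₁ x)       = top x
  merge (inj₂ (x , _)) = inj₁ x

  split-inC : ∀ x (c : T (C x)) → split (inj₁ x) ≡ inj₂ (x , c)
  split-inC x c with inC? x
  ... | inj₁ c' = cong (λ c → inj₂ (x , c)) (T-irrelevant c' c)
  ... | inj₂ ¬c = ⊥-elim (¬c c)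

  split-notC : ∀ x → ¬ T (C x) → split (inj₁ x) ≡ inj₁ x
  split-notC x ¬c with inC? x
  ... | inj₁ c = ⊥-elim (¬c c)
  ... | inj₂ _ = refl

  split-top : ∀ x → split (top x) ≡ inj₁ x
  split-top x = [ (λ c → cong split (top-inC x c))
                , (λ ¬c → trans (cong split (top-notC x ¬c)) (split-notC x ¬c)) ]′ (inC? x)

  split-merge : ∀ b → split (merge b) ≡ b
  split-merge (inj₁ x)       = split-top x
  split-merge (inj₂ (x , c)) = split-inC x c

  merge-split : ∀ u → merge (split u) ≡ u
  merge-split (inj₁ x) = [ (λ c → cong merge (split-inC x c))
                         , (λ ¬c → trans (cong merge (split-notC x ¬c)) (top-notC x ¬c)) ]′ (inC? x)
  merge-split (inj₂ (x , c)) = top-inC x c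

  inC-step : ∀ {x y} → OGraph.red S.graph x y ⊎ OGraph.blue S.graph x y → T (C x) → T (C y)
  inC-step {x} {y} e cx = Equivalence.from T-≡ (Equivalence.from (C-comp y)
    (Equivalence.to (C-comp x) (Equivalence.to T-≡ cx) ◅◅ e ◅ ε))

  CEdge : InC → InC → Set
  CEdge (x , _) (y , _) = S.red x y ⊎ S.blue x y

  CEdge-sym : Symmetric CEdge
  CEdge-sym (inj₁ r) = inj₁ (S.red-sym r)
  CEdge-sym (inj₂ b) = inj₂ (S.blue-sym b)

  liftPath : ∀ {x y} → OGraph.Conn S.graph x y → (cx : T (C x)) (cy : T (C y)) → Star CEdge (x , cx) (y , cy)
  liftPath ε        cx cy rewrite T-irrelevant cx cy = ε
  liftPath (e ◅ es) cx cy = e ◅ liftPath es (inC-step e cx) cy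

  x₀∈C : T (C x₀)
  x₀∈C = Equivalence.from T-≡ (Equivalence.from (C-comp x₀) ε)

  InC-connected : ∀ d → Star CEdge (x₀ , x₀∈C) d
  InC-connected (y , cy) = liftPath (Equivalence.to (C-comp y) (Equivalence.to T-≡ cy)) x₀∈C cy

  module SegS = Segments GH S (≤-trans (s≤s z≤n) (toℕ<n x₀))
  module SegU = Segments GH U (≤-trans (s≤s z≤n) (toℕ<n (from (inj₁ x₀))))

  Adj : Fin S.m ⊎ InC → Fin S.m ⊎ InC → Set
  Adj = Pointwise SegS.SegmentAdj CEdge

  splitPrev : UV → Fin S.m ⊎ InC
  splitPrev (inj₁ x) = inj₁ (prev x)
  splitPrev (inj₂ d) = inj₂ d

  split-to-prev : ∀ i → split (to (prev i)) ≡ splitPrev (to i)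
  split-to-prev i = go (to i) refl
    where
    go : ∀ u → to i ≡ u → split (to (prev i)) ≡ splitPrev u
    go (inj₁ x)       to-i = trans (cong split (to-prev-old to-i)) (split-top (prev x))
    go (inj₂ (x , c)) to-i = trans (cong split (to-prev-new to-i)) (split-inC x c)

  ured⇒Adj : ∀ u u' → ured S.graph C u u' → Adj (split u) (split u')
  ured⇒Adj (inj₁ x) (inj₁ y) r = [ inside , outside ]′ (inC? x)
    where
    inside : T (C x) → Adj (split (inj₁ x)) (split (inj₁ y))
    inside c = subst₂ Adj (sym (split-inC x c)) (sym (split-inC y (inC-step (inj₁ r) c))) (inj₂ (inj₁ r))
    outside : ¬ T (C x) → Adj (split (inj₁ x)) (split (inj₁ y))
    outside ¬c = subst₂ Adj (sym (split-notC x ¬c)) (sym (split-notC y (¬c ∘ inC-step (inj₁ (S.red-sym r)))))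
                   (inj₁ (inj₁ r))
  ured⇒Adj (inj₂ _) (inj₂ _) r = inj₁ (inj₁ r)

  ublue⇒Adj : ∀ u u' → ublue S.graph C u u' → Adj (splitPrev u) (splitPrev u')
  ublue⇒Adj (inj₁ x) (inj₁ y) b = inj₁ (inj₂ (x , y , b , refl , refl))
  ublue⇒Adj (inj₂ _) (inj₂ _) b = inj₂ (inj₂ b)

  π : Fin U.m → Fin S.m ⊎ InC
  π = split ∘ to

  ρ : Fin S.m ⊎ InC → Fin U.m
  ρ = from ∘ merge

  π-ρ : ∀ b → π (ρ b) ≡ b
  π-ρ b = trans (cong split (to-from _)) (split-merge b)

  ρ-π : ∀ i → ρ (π i) ≡ i
  ρ-π i = trans (cong from (merge-split _)) (from-to i)

  SegmentAdjU⇒Adj : ∀ {i j} → SegU.SegmentAdj i j → Adj (π i) (π j)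
  SegmentAdjU⇒Adj {i} {j} (inj₁ r) = ured⇒Adj (to i) (to j) (Equivalence.to (φ-red i j) r)
  SegmentAdjU⇒Adj (inj₂ (i' , j' , b , refl , refl)) =
    subst₂ Adj (sym (split-to-prev i')) (sym (split-to-prev j')) (ublue⇒Adj _ _ (Equivalence.to (φ-blue i' j') b))

  U-red : ∀ u u' → ured S.graph C u u' → U.red (from u) (from u')
  U-red u u' = Equivalence.from (φ-red _ _) ∘ subst₂ (ured S.graph C) (sym (to-from u)) (sym (to-from u'))

  U-blue : ∀ u u' → ublue S.graph C u u' → U.blue (from u) (from u')
  U-blue u u' = Equivalence.from (φ-blue _ _) ∘ subst₂ (ublue S.graph C) (sym (to-from u)) (sym (to-from u'))

  ured-top : ∀ {x y} → S.red x y → ured S.graph C (top x) (top y)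
  ured-top {x} {y} r = [ inside , outside ]′ (inC? x)
    where
    inside : T (C x) → ured S.graph C (top x) (top y)
    inside c = subst₂ (ured S.graph C) (sym (top-inC x c)) (sym (top-inC y (inC-step (inj₁ r) c))) r
    outside : ¬ T (C x) → ured S.graph C (top x) (top y)
    outside ¬c =
      subst₂ (ured S.graph C) (sym (top-notC x ¬c)) (sym (top-notC y (¬c ∘ inC-step (inj₁ (S.red-sym r))))) r

  prev-from : ∀ {i u} → to (prev i) ≡ u → prev i ≡ from u
  prev-from to-prev = trans (sym (from-to _)) (cong from to-prev)

  Adj⇒SegmentAdjU : ∀ {b b'} → Adj b b' → SegU.SegmentAdj (ρ b) (ρ b')
  Adj⇒SegmentAdjU (inj₁ (inj₁ r)) = inj₁ (U-red _ _ (ured-top r))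
  Adj⇒SegmentAdjU (inj₁ (inj₂ (x' , y' , b , refl , refl))) =
    inj₂ (from (inj₁ x') , from (inj₁ y') , U-blue _ _ b ,
          prev-from (to-prev-old (to-from _)) , prev-from (to-prev-old (to-from _)))
  Adj⇒SegmentAdjU (inj₂ (inj₁ r)) = inj₁ (U-red (inj₁ _) (inj₁ _) r)
  Adj⇒SegmentAdjU (inj₂ {x , c} {y , c'} (inj₂ b)) =
    inj₂ (from (inj₂ (x , c)) , from (inj₂ (y , c')) , U-blue _ _ b ,
          prev-from (to-prev-new (to-from _)) , prev-from (to-prev-new (to-from _)))

  components-SegmentAdjU≃Adj : ∀ k → HasComponents SegU.SegmentAdj k ⇔ HasComponents Adj k
  components-SegmentAdjU≃Adj = HasComponents-surjection π (λ b → ρ b , π-ρ b)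
    (Star-⇔-retraction SegU.SegmentAdj-sym π ρ π-ρ (λ i → subst (λ j → Star _ j i) (sym (ρ-π i)) ε)
      (λ e → SegmentAdjU⇒Adj e ◅ ε) (λ e → Adj⇒SegmentAdjU e ◅ ε))

  components-add-C : ∀ k → HasComponents SegS.SegmentAdj k ⇔ HasComponents Adj (suc k)
  components-add-C = HasComponents-⊎-connected (λ {d} {d'} → CEdge-sym {d} {d'}) (x₀ , x₀∈C) InC-connected

  components-suc : ∀ k → NumComponents S k ⇔ NumComponents U (suc k)
  components-suc k = begin
    NumComponents S k                ≈⟨ SegS.components-F≃SegmentAdj k ⟩
    HasComponents SegS.SegmentAdj k  ≈⟨ components-add-C k ⟩
    HasComponents Adj (suc k)        ≈⟨ ⇔-sym (components-SegmentAdjU≃Adj (suc k)) ⟩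
    HasComponents SegU.SegmentAdj (suc k) ≈⟨ ⇔-sym (SegU.components-F≃SegmentAdj (suc k)) ⟩
    NumComponents U (suc k)          ∎
    where open SetoidReasoning (⇔-setoid 0ℓ)

lemma3p8 : ∀ {n} (GH : HamGraph n) (S U : Sub.SubA GH) →
    IsDUACC (Sub.SubA.graph S) → Sub.NoNeighbouring GH S →
    Sub.NoNeighbouring GH U → IsGoingUp (Sub.SubA.graph U) (Sub.SubA.graph S) →
    ∀ (k : ℕ) → Sub.NumComponents GH S k ⇔ Sub.NumComponents GH U (suc k)
lemma3p8 GH S U _ _ _ (C , (x₀ , C-comp) , φ , φ-mono , φ-red , φ-blue) =
  GoingUp.components-suc GH S U C x₀ C-comp φ φ-mono φ-red φ-blue
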